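{- Let $k$ be a positive integer and let $\mathcal{H}$ be a $1$-intersecting $k$-graph that is not a sunflower. Then \[ \mathrm{Ord} (\mathcal{H}) + \mathrm{Ker} (\mathcal{H}) \le \frac{4}{27}k^3 + 4k^{5/2}. \]
   Context: A $k$-graph is a $k$-uniform hypergraph. A hypergraph is $1$-intersecting if every pair of distinct edges shares exactly one vertex; it is intersecting if every pair of distinct edges shares at least one vertex. A hypergraph $\mathcal{H}$ is a sunflower if $e_1\cap e_2=\bigcap_{e\in E(\mathcal{H})} e$ for all distinct edges $e_1,e_2$. The order $\mathrm{Ord}(\mathcal{H})$ is the number of non-isolated vertices. For an intersecting hypergraph $\mathcal{H}$, a set $A\subseteq V(\mathcal{H})$ is a kernel if (i) $A\cap e\neq\varnothing$ for every edge $e$, and (ii) the hypergraph on vertex set $A$ with edges $\{A\cap e: e\in E(\mathcal{H})\}$ is intersecting. $\mathrm{Ker}(\mathcal{H})$ denotes the minimum size of a kernel of $\mathcal{H}$. -}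

module Defs where

open import Data.Nat using (ℕ; _+_; _*_; _∸_; _^_; _≤_)
open import Data.Fin using (Fin)
open import Data.Fin.Subset using (Subset; _∩_; ⋃; ⋂; ∣_∣; Nonempty)
open import Data.List using (tabulate)
open import Data.Product using (_×_; ∃)
open import Relation.Binary.PropositionalEquality using (_≡_; _≢_)
open import Function.Definitions using (Injective)

record Hypergraph (n : ℕ) : Set where
  field
    m        : ℕ
    edge     : Fin m → Subset n
    distinct : Injective _≡_ _≡_ edge

open Hypergraph public

IsUniform : ∀ {n} → ℕ → Hypergraph n → Set
IsUniform k H = ∀ i → ∣ edge H i ∣ ≡ k

IsOneIntersecting : ∀ {n} → Hypergraph n → Set
IsOneIntersecting H = ∀ i j → i ≢ j → ∣ edge H i ∩ edge H j ∣ ≡ 1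

coreSet : ∀ {n} → Hypergraph n → Subset n
coreSet H = ⋂ (tabulate (edge H))

IsSunflower : ∀ {n} → Hypergraph n → Set
IsSunflower H = ∀ i j → i ≢ j → edge H i ∩ edge H j ≡ coreSet H

-- number of non-isolated vertices = size of union of all edges
Ord : ∀ {n} → Hypergraph n → ℕ
Ord H = ∣ ⋃ (tabulate (edge H)) ∣

IsKernel : ∀ {n} → Hypergraph n → Subset n → Set
IsKernel H A = (∀ i → Nonempty (A ∩ edge H i))
             × (∀ i j → Nonempty ((A ∩ edge H i) ∩ (A ∩ edge H j)))

IsKer : ∀ {n} → Hypergraph n → ℕ → Set
IsKer H c = (∃ λ A → IsKernel H A × ∣ A ∣ ≡ c)
          × (∀ A → IsKernel H A → c ≤ ∣ A ∣)

-- x ≤ (4/27) k^3 + 4 k^(5/2), stated over ℕ: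
-- equivalent to  d ≤ 108 k^2 √k  with d = 27x ∸ 4k^3, i.e. d² ≤ 108² k^5
BoundHolds : ℕ → ℕ → Set
BoundHolds k x = let d = 27 * x ∸ 4 * k ^ 3 in d * d ≤ 11664 * k ^ 5

-- Let v₀ be a vertex of maximum degree Δ. The vertices of degree at least 2 form a kernel,
-- so Ord + Ker ≤ Σ_v min(2, deg v). The vertices covered by the Δ edges through v₀ contribute
-- at most 2Δk; let X be the contribution of the others. As H is not a sunflower, some M ≥ 1
-- edges avoid v₀; each of them meets the edges through v₀ in Δ distinct vertices and every
-- other edge exactly once. Double counting over these edges, together with
-- Δ·min(2, d) ≤ d(Δ + 2 − d) for d ≤ Δ, gives X + MΔ ≤ Mk and ΔX + M(M + 3Δ) ≤ M(Δk + k + 1).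
-- Eliminating M (by AM-GM if 2Δ ≤ k, and through 27Δ²(k − Δ) ≤ 4k³ otherwise) yields
-- 27X ≤ 4k³ + 54k², hence 27(Ord + Ker) ≤ 4k³ + 108k².

module Submission where

open import Defs
open import Algebra.Properties.Semiring.Sum as Sum using ()
open import Data.Bool.Base using (Bool; true; false; _∧_; _∨_)
open import Data.Empty using (⊥-elim)
open import Data.Fin.Base using (Fin; zero; suc; punchIn)
open import Data.Fin.Properties using () renaming (_≟_ to _≟ᶠ_)
import Data.Fin.Properties as Fin
open import Data.Nat.Base
open import Data.Nat.Properties
open import Data.Nat.Tactic.RingSolver using (solve-∀)
open import Data.Product.Base using (∃; _×_; _,_; proj₁; proj₂)
open import Data.Sum.Base using (_⊎_; inj₁; inj₂)
open import Relation.Binary.PropositionalEquality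
open import Relation.Nullary using (¬_; yes; no; does)
open import Relation.Nullary.Decidable using (dec-true)
open import Data.Vec.Base using ([]; _∷_; lookup; tabulate)
open import Data.Vec.Properties using (lookup-zipWith; lookup-replicate; lookup∘tabulate; []=⇒lookup; lookup⇒[]=)
open import Data.Fin.Subset using (Subset; _∈_; _∉_; _∩_; ⋃; ⋂; ∣_∣; Nonempty)
open import Data.Fin.Subset.Properties using (∈⊤; x∈p∩q⁺; x∈p∩q⁻; _∈?_; ⊆-antisym)
import Data.List.Base as List
open import Data.List.Extrema.Nat using (argmax; f[xs]≤f[argmax])
open import Data.List.Membership.Propositional.Properties using (∈-allFin)
import Data.List.Relation.Unary.All as All
open import Function.Base using (_∘_)

open Sum +-*-semiring
  using (sum; sum-syntax; sum-cong-≗; ∑-distrib-+; ∑-comm; *-distribˡ-sum; *-distribʳ-sum; sum-remove)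

private
  variable
    n s : ℕ

∑-mono-≤ : {f g : Fin s → ℕ} → (∀ i → f i ≤ g i) → sum f ≤ sum g
∑-mono-≤ {zero}  f≤g = z≤n
∑-mono-≤ {suc s} f≤g = +-mono-≤ (f≤g zero) (∑-mono-≤ (f≤g ∘ suc))

∑-const : ∀ s c → ∑[ i < s ] c ≡ s * c
∑-const zero    c = refl
∑-const (suc s) c = cong (c +_) (∑-const s c)

≤-∑ : (f : Fin s → ℕ) (i : Fin s) → f i ≤ sum f
≤-∑ f zero    = m≤m+n _ _
≤-∑ f (suc i) = ≤-trans (≤-∑ (λ j → f (suc j)) i) (m≤n+m _ (f zero))

+-≤-∑ : (f : Fin s → ℕ) {i j : Fin s} → i ≢ j → f i + f j ≤ sum f
+-≤-∑ f {zero}  {zero}  i≢j = ⊥-elim (i≢j refl)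
+-≤-∑ f {zero}  {suc j} _   = +-monoʳ-≤ (f zero) (≤-∑ (λ j → f (suc j)) j)
+-≤-∑ f {suc i} {zero}  _   = subst (_≤ sum f) (+-comm (f zero) (f (suc i)))
                                (+-monoʳ-≤ (f zero) (≤-∑ (λ j → f (suc j)) i))
+-≤-∑ f {suc i} {suc j} i≢j = ≤-trans (+-≤-∑ (λ j → f (suc j)) (λ i≡j → i≢j (cong suc i≡j)))
                                      (m≤n+m _ (f zero))

∑≢0⇒∃≢0 : (f : Fin s → ℕ) → sum f ≢ 0 → ∃ λ i → f i ≢ 0
∑≢0⇒∃≢0 {zero}  f ∑f≢0 = ⊥-elim (∑f≢0 refl)
∑≢0⇒∃≢0 {suc s} f ∑f≢0 with f zero ≟ 0
... | no  f₀≢0 = zero , f₀≢0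
... | yes f₀≡0 = let i , fᵢ≢0 = ∑≢0⇒∃≢0 (λ i → f (suc i)) (λ ∑≡0 → ∑f≢0 (cong₂ _+_ f₀≡0 ∑≡0))
                 in suc i , fᵢ≢0

distinct-pair : {P : Fin s → Fin s → Set} → ¬ (∀ i j → i ≢ j → P i j) → ∃ λ (a : Fin s) → ∃ λ b → a ≢ b
distinct-pair {zero}        ¬∀ = ⊥-elim (¬∀ (λ ()))
distinct-pair {suc zero}    ¬∀ = ⊥-elim (¬∀ (λ { zero zero 0≢0 → ⊥-elim (0≢0 refl) }))
distinct-pair {suc (suc s)} _  = zero , suc zero , λ ()

∑-≡0 : {f : Fin s → ℕ} → (∀ i → f i ≡ 0) → sum f ≡ 0
∑-≡0 {s} f≡0 = trans (sum-cong-≗ f≡0) (trans (∑-const s 0) (*-zeroʳ s))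

∑-≤-1 : (f : Fin s → ℕ) → (∀ i → f i ≤ 1) → (∀ {i j} → f i ≢ 0 → f j ≢ 0 → i ≡ j) → sum f ≤ 1
∑-≤-1 {zero}  f _   _      = z≤n
∑-≤-1 {suc s} f f≤1 unique with f zero ≟ 0
... | yes f₀≡0 = subst (λ x → x + sum (f ∘ suc) ≤ 1) (sym f₀≡0)
                   (∑-≤-1 (f ∘ suc) (f≤1 ∘ suc) (λ fᵢ≢0 fⱼ≢0 → Fin.suc-injective (unique fᵢ≢0 fⱼ≢0)))
... | no  f₀≢0 = begin
  f zero + sum (f ∘ suc)     ≡⟨ cong (f zero +_) (∑-≡0 tail≡0) ⟩
  f zero + 0                 ≡⟨ +-identityʳ (f zero) ⟩
  f zero                     ≤⟨ f≤1 zero ⟩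
  1                          ∎
  where
  open ≤-Reasoning
  tail≡0 : ∀ i → f (suc i) ≡ 0
  tail≡0 i with f (suc i) ≟ 0
  ... | yes fᵢ≡0 = fᵢ≡0
  ... | no  fᵢ≢0 with () ← unique f₀≢0 fᵢ≢0

∑-except : (f : Fin s → ℕ) (i : Fin s) → (∀ j → j ≢ i → f j ≡ 1) → sum f + 1 ≡ f i + s
∑-except {suc s} f i others = begin
  sum f + 1                         ≡⟨ cong (_+ 1) (sum-remove f) ⟩
  f i + sum (f ∘ punchIn i) + 1     ≡⟨ cong (λ x → f i + x + 1) rest ⟩
  f i + s * 1 + 1                   ≡⟨ cong (λ x → f i + x + 1) (*-identityʳ s) ⟩
  f i + s + 1                       ≡⟨ +-assoc (f i) s 1 ⟩
  f i + (s + 1)                     ≡⟨ cong (f i +_) (+-comm s 1) ⟩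
  f i + suc s                       ∎
  where
  open ≡-Reasoning
  rest : sum (f ∘ punchIn i) ≡ s * 1
  rest = trans (sum-cong-≗ (λ j → others (punchIn i j) (Fin.punchInᵢ≢i i j))) (∑-const s 1)

𝟙 : Bool → ℕ
𝟙 true  = 1
𝟙 false = 0

χ : Subset n → Fin n → ℕ
χ p v = 𝟙 (lookup p v)

χ≤1 : ∀ (p : Subset n) v → χ p v ≤ 1
χ≤1 p v with lookup p v
... | true  = ≤-refl
... | false = z≤n

χ-idem : ∀ (p : Subset n) v → χ p v * χ p v ≡ χ p v
χ-idem p v with lookup p v
... | true  = refl
... | false = refl

χ-∩ : ∀ (p q : Subset n) v → χ (p ∩ q) v ≡ χ p v * χ q v
χ-∩ p q v rewrite lookup-zipWith _∧_ v p q with lookup p v | lookup q v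
... | true  | true  = refl
... | true  | false = refl
... | false | _     = refl

∣p∣≡∑χ : (p : Subset n) → ∣ p ∣ ≡ ∑[ v < n ] χ p v
∣p∣≡∑χ []          = refl
∣p∣≡∑χ (true  ∷ p) = cong suc (∣p∣≡∑χ p)
∣p∣≡∑χ (false ∷ p) = ∣p∣≡∑χ p

∈⇒χ≡1 : ∀ {p : Subset n} {v} → v ∈ p → χ p v ≡ 1
∈⇒χ≡1 v∈p = cong 𝟙 ([]=⇒lookup v∈p)

∉⇒χ≡0 : ∀ {p : Subset n} {v} → v ∉ p → χ p v ≡ 0
∉⇒χ≡0 {p = p} {v = v} v∉p with lookup p v in eq
... | true  = ⊥-elim (v∉p (lookup⇒[]= v p eq))
... | false = refl

χ≢0⇒∈ : ∀ {p : Subset n} {v} → χ p v ≢ 0 → v ∈ p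
χ≢0⇒∈ {p = p} {v = v} χ≢0 with lookup p v in eq
... | true  = lookup⇒[]= v p eq
... | false = ⊥-elim (χ≢0 refl)

χ-⋃ : (e : Fin s → Subset n) (v : Fin n) → χ (⋃ (List.tabulate e)) v ≡ 1 ⊓ ∑[ i < s ] χ (e i) v
χ-⋃ {s = zero}  e v = cong 𝟙 (lookup-replicate v false)
χ-⋃ {s = suc s} e v rewrite lookup-zipWith _∨_ v (e zero) (⋃ (List.tabulate (e ∘ suc))) with lookup (e zero) v
... | true  = refl
... | false = χ-⋃ (e ∘ suc) v

∈-⋂⁺ : (e : Fin s → Subset n) {v : Fin n} → (∀ i → v ∈ e i) → v ∈ ⋂ (List.tabulate e)
∈-⋂⁺ {s = zero}  e _   = ∈⊤
∈-⋂⁺ {s = suc s} e v∈e = x∈p∩q⁺ (v∈e zero , ∈-⋂⁺ (e ∘ suc) (v∈e ∘ suc))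

∈-⋂⁻ : (e : Fin s → Subset n) {v : Fin n} → v ∈ ⋂ (List.tabulate e) → ∀ i → v ∈ e i
∈-⋂⁻ {s = suc s} e v∈⋂ zero    = proj₁ (x∈p∩q⁻ (e zero) _ v∈⋂)
∈-⋂⁻ {s = suc s} e v∈⋂ (suc i) = ∈-⋂⁻ (e ∘ suc) (proj₂ (x∈p∩q⁻ (e zero) _ v∈⋂)) i

≤-from-slack : ∀ {a b} c → b ≡ a + c → a ≤ b
≤-from-slack {a} c refl = m≤m+n a c

slack : ∀ {a b} → a ≤ b → ∃ λ c → b ≡ a + c
slack a≤b = let c , a+c≡b = m≤n⇒∃[o]m+o≡n a≤b in c , sym a+c≡b

private
  2mn≤m²+n²-ordered : ∀ {m n} → n ≤ m → 2 * (m * n) ≤ m * m + n * n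
  2mn≤m²+n²-ordered {n = n} n≤m with slack n≤m
  ... | e , refl = ≤-from-slack (e * e) (identity n e)
    where
    identity : ∀ n e → (n + e) * (n + e) + n * n ≡ 2 * ((n + e) * n) + e * e
    identity = solve-∀

2mn≤m²+n² : ∀ m n → 2 * (m * n) ≤ m * m + n * n
2mn≤m²+n² m n with ≤-total n m
... | inj₁ n≤m = 2mn≤m²+n²-ordered n≤m
... | inj₂ m≤n = subst₂ _≤_ (cong (2 *_) (*-comm n m)) (+-comm (n * n) (m * m)) (2mn≤m²+n²-ordered m≤n)

-- AM-GM for l/2, l/2 and D.
27l²D≤4[l+D]³ : ∀ l D → 27 * (l * l * D) ≤ 4 * ((l + D) * (l + D) * (l + D))
27l²D≤4[l+D]³ l D with ≤-total (2 * D) l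
... | inj₁ 2D≤l = let a , l≡2D+a = slack 2D≤l in
  subst (λ l → 27 * (l * l * D) ≤ 4 * ((l + D) * (l + D) * (l + D))) (sym l≡2D+a)
        (≤-from-slack (a * a * (9 * D + 4 * a)) (identity D a))
  where
  identity : ∀ D a → 4 * ((2 * D + a + D) * (2 * D + a + D) * (2 * D + a + D))
                   ≡ 27 * ((2 * D + a) * (2 * D + a) * D) + a * a * (9 * D + 4 * a)
  identity = solve-∀
... | inj₂ l≤2D = let a , 2D≡l+a = slack l≤2D in *-cancelˡ-≤ 8 (begin
  8 * (27 * (l * l * D))                          ≡⟨ identity₁ l D ⟩
  108 * (l * l * (2 * D))                         ≡⟨ cong (λ t → 108 * (l * l * t)) 2D≡l+a ⟩
  108 * (l * l * (l + a))                         ≤⟨ ≤-from-slack (36 * l * a * a + 4 * (a * a * a)) (identity₂ l a) ⟩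
  4 * ((2 * l + (l + a)) * (2 * l + (l + a)) * (2 * l + (l + a)))
                                                  ≡⟨ cong (λ t → 4 * ((2 * l + t) * (2 * l + t) * (2 * l + t))) 2D≡l+a ⟨
  4 * ((2 * l + 2 * D) * (2 * l + 2 * D) * (2 * l + 2 * D))
                                                  ≡⟨ identity₃ l D ⟩
  8 * (4 * ((l + D) * (l + D) * (l + D)))         ∎)
  where
  open ≤-Reasoning
  identity₁ : ∀ l D → 8 * (27 * (l * l * D)) ≡ 108 * (l * l * (2 * D))
  identity₁ = solve-∀
  identity₂ : ∀ l a → 4 * ((2 * l + (l + a)) * (2 * l + (l + a)) * (2 * l + (l + a))) ≡ 108 * (l * l * (l + a)) + (36 * l * a * a + 4 * (a * a * a))
  identity₂ = solve-∀
  identity₃ : ∀ l D → 4 * ((2 * l + 2 * D) * (2 * l + 2 * D) * (2 * l + 2 * D)) ≡ 8 * (4 * ((l + D) * (l + D) * (l + D)))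
  identity₃ = solve-∀

Δ*[2⊓d]≤d*[Δ+2∸d] : ∀ {Δ} d → d ≤ Δ → Δ * (2 ⊓ d) ≤ d * (Δ + 2 ∸ d)
Δ*[2⊓d]≤d*[Δ+2∸d] {Δ} 0 _ = ≤-reflexive (*-zeroʳ Δ)
Δ*[2⊓d]≤d*[Δ+2∸d] {Δ} 1 _ = begin
  Δ * 1               ≡⟨ *-identityʳ Δ ⟩
  Δ                   ≤⟨ m≤m+n Δ 1 ⟩
  Δ + 1               ≡⟨ +-∸-assoc Δ (s≤s z≤n) ⟨
  Δ + 2 ∸ 1           ≡⟨ *-identityˡ (Δ + 2 ∸ 1) ⟨
  1 * (Δ + 2 ∸ 1)     ∎
  where open ≤-Reasoning
Δ*[2⊓d]≤d*[Δ+2∸d] {Δ} (suc (suc t)) 2+t≤Δ = let s , Δ≡2+t+s = slack 2+t≤Δ in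
  subst (λ Δ → Δ * 2 ≤ (2 + t) * (Δ + 2 ∸ (2 + t))) (sym Δ≡2+t+s) (begin
    (2 + t + s) * 2                    ≤⟨ m≤m+n _ (t * s) ⟩
    (2 + t + s) * 2 + t * s            ≡⟨ identity t s ⟩
    (2 + t) * (s + 2)                  ≡⟨ cong ((2 + t) *_) (m+n∸m≡n (2 + t) (s + 2)) ⟨
    (2 + t) * (2 + t + (s + 2) ∸ (2 + t)) ≡⟨ cong (λ x → (2 + t) * (x ∸ (2 + t))) (+-assoc (2 + t) s 2) ⟨
    (2 + t) * (2 + t + s + 2 ∸ (2 + t)) ∎)
  where
  open ≤-Reasoning
  identity : ∀ t s → (2 + t + s) * 2 + t * s ≡ (2 + t) * (s + 2)
  identity = solve-∀

edge-count-bound : ∀ {Y S r u Δ k m} → Y + S ≤ (Δ + 2) * r + Δ * u → S + 1 ≡ k + m →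
                   r + u ≡ k → Δ ≤ u → Y + (m + 2 * Δ) ≤ Δ * k + k + 1
edge-count-bound {Y} {S} {r} {u} {Δ} {k} {m} Y+S≤ S+1≡k+m r+u≡k Δ≤u = +-cancelʳ-≤ k _ _ (begin
  Y + (m + 2 * Δ) + k                  ≡⟨ identity₁ Y m Δ k ⟩
  Y + (k + m) + 2 * Δ                  ≡⟨ cong (λ t → Y + t + 2 * Δ) S+1≡k+m ⟨
  Y + (S + 1) + 2 * Δ                  ≡⟨ identity₂ Y S Δ ⟩
  Y + S + (1 + 2 * Δ)                  ≤⟨ +-mono-≤ Y+S≤ (+-monoʳ-≤ 1 (*-monoʳ-≤ 2 Δ≤u)) ⟩
  (Δ + 2) * r + Δ * u + (1 + 2 * u)    ≡⟨ identity₃ Δ r u ⟩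
  (Δ + 2) * (r + u) + 1                ≡⟨ cong (λ t → (Δ + 2) * t + 1) r+u≡k ⟩
  (Δ + 2) * k + 1                      ≡⟨ identity₄ Δ k ⟩
  Δ * k + k + 1 + k                    ∎)
  where
  open ≤-Reasoning
  identity₁ : ∀ Y m Δ k → Y + (m + 2 * Δ) + k ≡ Y + (k + m) + 2 * Δ
  identity₁ = solve-∀
  identity₂ : ∀ Y S Δ → Y + (S + 1) + 2 * Δ ≡ Y + S + (1 + 2 * Δ)
  identity₂ = solve-∀
  identity₃ : ∀ Δ r u → (Δ + 2) * r + Δ * u + (1 + 2 * u) ≡ (Δ + 2) * (r + u) + 1
  identity₃ = solve-∀
  identity₄ : ∀ Δ k → (Δ + 2) * k + 1 ≡ Δ * k + k + 1 + k
  identity₄ = solve-∀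

27X≤-when-2Δ≤k : ∀ {Δ k M X} → 1 ≤ Δ → 2 * Δ ≤ k →
                 Δ * X + M * (M + 3 * Δ) ≤ M * (Δ * k + k + 1) →
                 27 * X ≤ 4 * (k * k * k) + 54 * (k * k)
27X≤-when-2Δ≤k {Δ} {k} {M} {X} 1≤Δ 2Δ≤k ΔX+M[M+3Δ]≤ = *-cancelˡ-≤ (4 * Δ) {{4Δ≢0}} (begin
  4 * Δ * (27 * X)                           ≡⟨ identity₁ Δ X ⟩
  27 * (4 * (Δ * X))                         ≤⟨ *-monoʳ-≤ 27 4ΔX≤B² ⟩
  27 * (B * B)                               ≤⟨ *-monoʳ-≤ 27 (*-mono-≤ B≤[Δ+2]k B≤[Δ+2]k) ⟩
  27 * ((Δ + 2) * k * ((Δ + 2) * k))         ≡⟨ identity₂ Δ k ⟩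
  k * k * (27 * ((Δ + 2) * (Δ + 2)))         ≤⟨ *-monoʳ-≤ (k * k) 27[Δ+2]²≤ ⟩
  k * k * (16 * (Δ * k) + 216 * Δ)           ≡⟨ identity₃ Δ k ⟩
  4 * Δ * (4 * (k * k * k) + 54 * (k * k))   ∎)
  where
  open ≤-Reasoning
  identity₁ : ∀ Δ X → 4 * Δ * (27 * X) ≡ 27 * (4 * (Δ * X))
  identity₁ = solve-∀
  identity₂ : ∀ Δ k → 27 * ((Δ + 2) * k * ((Δ + 2) * k)) ≡ k * k * (27 * ((Δ + 2) * (Δ + 2)))
  identity₂ = solve-∀
  identity₃ : ∀ Δ k → k * k * (16 * (Δ * k) + 216 * Δ) ≡ 4 * Δ * (4 * (k * k * k) + 54 * (k * k))
  identity₃ = solve-∀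
  identity₄ : ∀ M B → 4 * (M * B) ≡ 2 * (2 * M * B)
  identity₄ = solve-∀
  identity₅ : ∀ M B → 2 * M * (2 * M) + B * B ≡ B * B + 4 * (M * M)
  identity₅ = solve-∀
  identity₆ : ∀ Δ k → Δ * k + k + k ≡ (Δ + 2) * k
  identity₆ = solve-∀
  identity₇ : ∀ g f → 16 * ((1 + g) * (2 * (1 + g) + f)) + 216 * (1 + g)
                    ≡ 27 * ((1 + g + 2) * (1 + g + 2)) + (5 + 118 * g + 5 * (g * g) + 16 * f + 16 * (f * g))
  identity₇ = solve-∀
  B : ℕ
  B = Δ * k + k + 1
  4Δ≢0 : NonZero (4 * Δ)
  4Δ≢0 = >-nonZero (≤-trans (s≤s z≤n) (*-monoʳ-≤ 4 1≤Δ))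
  4ΔX≤B² : 4 * (Δ * X) ≤ B * B
  4ΔX≤B² = +-cancelʳ-≤ (4 * (M * M)) _ _ (begin
    4 * (Δ * X) + 4 * (M * M)   ≡⟨ *-distribˡ-+ 4 (Δ * X) (M * M) ⟨
    4 * (Δ * X + M * M)         ≤⟨ *-monoʳ-≤ 4 (≤-trans (+-monoʳ-≤ (Δ * X) (*-monoʳ-≤ M (m≤m+n M (3 * Δ)))) ΔX+M[M+3Δ]≤) ⟩
    4 * (M * B)                 ≡⟨ identity₄ M B ⟩
    2 * (2 * M * B)             ≤⟨ 2mn≤m²+n² (2 * M) B ⟩
    2 * M * (2 * M) + B * B     ≡⟨ identity₅ M B ⟩
    B * B + 4 * (M * M)         ∎)
  B≤[Δ+2]k : B ≤ (Δ + 2) * k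
  B≤[Δ+2]k = begin
    Δ * k + k + 1   ≤⟨ +-monoʳ-≤ (Δ * k + k) (≤-trans 1≤Δ (≤-trans (m≤n*m Δ 2) 2Δ≤k)) ⟩
    Δ * k + k + k   ≡⟨ identity₆ Δ k ⟩
    (Δ + 2) * k     ∎
  27[Δ+2]²≤ : 27 * ((Δ + 2) * (Δ + 2)) ≤ 16 * (Δ * k) + 216 * Δ
  27[Δ+2]²≤ = let g , Δ≡1+g = slack 1≤Δ ; f , k≡2Δ+f = slack 2Δ≤k in
    subst (λ k → 27 * ((Δ + 2) * (Δ + 2)) ≤ 16 * (Δ * k) + 216 * Δ) (sym k≡2Δ+f)
      (subst (λ Δ → 27 * ((Δ + 2) * (Δ + 2)) ≤ 16 * (Δ * (2 * Δ + f)) + 216 * Δ) (sym Δ≡1+g)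
        (≤-from-slack (5 + 118 * g + 5 * (g * g) + 16 * f + 16 * (f * g)) (identity₇ g f)))

27X≤-when-k<2Δ : ∀ {Δ D M X} → D < Δ → X + M * Δ ≤ M * (Δ + D) →
                 Δ * X + M * (M + 3 * Δ) ≤ M * (Δ * (Δ + D) + (Δ + D) + 1) →
                 27 * X ≤ 4 * ((Δ + D) * (Δ + D) * (Δ + D)) + 54 * ((Δ + D) * (Δ + D))
27X≤-when-k<2Δ {Δ} {D} {M} {X} D<Δ X+MΔ≤ ΔX+M[M+3Δ]≤ = begin
  27 * X                                                          ≤⟨ *-monoʳ-≤ 27 X≤ND ⟩
  27 * (N * D)                                                    ≡⟨ identity₁ Δ D ⟩
  27 * (Δ * Δ * D) + 27 * ((Δ + D) * D)                           ≤⟨ +-mono-≤ (27l²D≤4[l+D]³ Δ D) (*-monoʳ-≤ 27 (*-monoʳ-≤ (Δ + D) (m≤n+m D Δ))) ⟩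
  4 * ((Δ + D) * (Δ + D) * (Δ + D)) + 27 * ((Δ + D) * (Δ + D))   ≤⟨ +-monoʳ-≤ (4 * ((Δ + D) * (Δ + D) * (Δ + D))) (*-monoˡ-≤ ((Δ + D) * (Δ + D)) (m≤n+m 27 27)) ⟩
  4 * ((Δ + D) * (Δ + D) * (Δ + D)) + 54 * ((Δ + D) * (Δ + D))   ∎
  where
  open ≤-Reasoning
  identity₁ : ∀ Δ D → 27 * ((Δ * Δ + Δ + D) * D) ≡ 27 * (Δ * Δ * D) + 27 * ((Δ + D) * D)
  identity₁ = solve-∀
  -- Substituting Δ = 1 + D + f and M = 1 + N + e, the difference is a polynomial with nonnegative coefficients.
  identity₂ : ∀ D f e → let Δ = 1 + D + f ; M = 1 + (Δ * Δ + Δ + D) + e in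
    Δ * ((Δ * Δ + Δ + D) * D) + M * (M + 3 * Δ) ≡ M * (Δ * (Δ + D) + (Δ + D) + 1) +
      (9 + 20 * D + 6 * D * e + D * e * f + 26 * D * f + 9 * D * f * f + 14 * D * D + 9 * D * D * f
         + 3 * D * D * D + 6 * e + 6 * e * f + e * f * f + e * e + 18 * f + 12 * f * f + 3 * f * f * f)
  identity₂ = solve-∀
  N : ℕ
  N = Δ * Δ + Δ + D
  Δ≢0 : NonZero Δ
  Δ≢0 = >-nonZero (≤-<-trans z≤n D<Δ)
  X≤MD : X ≤ M * D
  X≤MD = +-cancelʳ-≤ (M * Δ) X (M * D)
           (subst (X + M * Δ ≤_) (trans (*-distribˡ-+ M Δ D) (+-comm (M * Δ) (M * D))) X+MΔ≤)
  large-M : ∀ {Δ M} → D < Δ → Δ * Δ + Δ + D < M →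
            M * (Δ * (Δ + D) + (Δ + D) + 1) ≤ Δ * ((Δ * Δ + Δ + D) * D) + M * (M + 3 * Δ)
  large-M {Δ} {M} D<Δ N<M = let f , Δ≡1+D+f = slack D<Δ ; e , M≡1+N+e = slack N<M in
    subst (λ M → M * (Δ * (Δ + D) + (Δ + D) + 1) ≤ Δ * ((Δ * Δ + Δ + D) * D) + M * (M + 3 * Δ)) (sym M≡1+N+e)
      (subst (λ Δ → let M = 1 + (Δ * Δ + Δ + D) + e in
                    M * (Δ * (Δ + D) + (Δ + D) + 1) ≤ Δ * ((Δ * Δ + Δ + D) * D) + M * (M + 3 * Δ)) (sym Δ≡1+D+f)
        (≤-from-slack _ (identity₂ D f e)))
  X≤ND : X ≤ N * D
  X≤ND with M ≤? N
  ... | yes M≤N = ≤-trans X≤MD (*-monoˡ-≤ D M≤N)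
  ... | no  M≰N = *-cancelˡ-≤ Δ {{Δ≢0}} (+-cancelʳ-≤ (M * (M + 3 * Δ)) _ _
                    (≤-trans ΔX+M[M+3Δ]≤ (large-M D<Δ (≰⇒> M≰N))))

27X≤4k³+54k² : ∀ {Δ k M X} → 1 ≤ Δ → Δ ≤ k → X + M * Δ ≤ M * k →
               Δ * X + M * (M + 3 * Δ) ≤ M * (Δ * k + k + 1) →
               27 * X ≤ 4 * (k * k * k) + 54 * (k * k)
27X≤4k³+54k² {Δ} {k} {M} {X} 1≤Δ Δ≤k X+MΔ≤ ΔX+M[M+3Δ]≤ with 2 * Δ ≤? k
... | yes 2Δ≤k = 27X≤-when-2Δ≤k {M = M} 1≤Δ 2Δ≤k ΔX+M[M+3Δ]≤
... | no  2Δ≰k = let D , k≡Δ+D = slack Δ≤k in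
  subst (λ k → 2 * Δ ≰ k → X + M * Δ ≤ M * k → Δ * X + M * (M + 3 * Δ) ≤ M * (Δ * k + k + 1) →
               27 * X ≤ 4 * (k * k * k) + 54 * (k * k))
        (sym k≡Δ+D) large-Δ 2Δ≰k X+MΔ≤ ΔX+M[M+3Δ]≤
  where
  large-Δ : ∀ {D} → 2 * Δ ≰ Δ + D → X + M * Δ ≤ M * (Δ + D) →
            Δ * X + M * (M + 3 * Δ) ≤ M * (Δ * (Δ + D) + (Δ + D) + 1) →
            27 * X ≤ 4 * ((Δ + D) * (Δ + D) * (Δ + D)) + 54 * ((Δ + D) * (Δ + D))
  large-Δ {D} 2Δ≰Δ+D = 27X≤-when-k<2Δ {M = M} (≰⇒> (2Δ≰Δ+D ∘ 2Δ≤Δ+D))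
    where
    2Δ≤Δ+D : Δ ≤ D → 2 * Δ ≤ Δ + D
    2Δ≤Δ+D Δ≤D = subst (_≤ Δ + D) (cong (Δ +_) (sym (+-identityʳ Δ))) (+-monoʳ-≤ Δ Δ≤D)

boundHolds : ∀ {k Δ M X x} → 1 ≤ Δ → Δ ≤ k → x ≤ 2 * (Δ * k) + X → X + M * Δ ≤ M * k →
             Δ * X + M * (M + 3 * Δ) ≤ M * (Δ * k + k + 1) → BoundHolds k x
boundHolds {k} {Δ} {M} {X} {x} 1≤Δ Δ≤k x≤ X+MΔ≤ ΔX+M[M+3Δ]≤ = begin
  (27 * x ∸ 4 * k ^ 3) * (27 * x ∸ 4 * k ^ 3)   ≤⟨ *-mono-≤ d≤108k² d≤108k² ⟩
  108 * (k * k) * (108 * (k * k))               ≡⟨ identity₁ k ⟩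
  11664 * (k * k * k * k)                       ≤⟨ *-monoʳ-≤ 11664 (m≤m*n (k * k * k * k) k) ⟩
  11664 * (k * k * k * k * k)                   ≡⟨ cong (11664 *_) (identity₂ k) ⟩
  11664 * k ^ 5                                 ∎
  where
  open ≤-Reasoning
  identity₁ : ∀ k → 108 * (k * k) * (108 * (k * k)) ≡ 11664 * (k * k * k * k)
  identity₁ = solve-∀
  identity₂ : ∀ k → k * k * k * k * k ≡ k * (k * (k * (k * (k * 1))))
  identity₂ = solve-∀
  identity₃ : ∀ k → k * (k * (k * 1)) ≡ k * k * k
  identity₃ = solve-∀
  identity₄ : ∀ a b → 27 * (2 * a + b) ≡ 54 * a + 27 * b
  identity₄ = solve-∀
  identity₅ : ∀ c s → 54 * s + (4 * c + 54 * s) ≡ 4 * c + 108 * s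
  identity₅ = solve-∀
  instance
    k≢0 : NonZero k
    k≢0 = >-nonZero (≤-trans 1≤Δ Δ≤k)
  d≤108k² : 27 * x ∸ 4 * k ^ 3 ≤ 108 * (k * k)
  d≤108k² = m≤n+o⇒m∸n≤o (27 * x) (4 * k ^ 3) (begin
    27 * x                                          ≤⟨ *-monoʳ-≤ 27 x≤ ⟩
    27 * (2 * (Δ * k) + X)                          ≡⟨ identity₄ (Δ * k) X ⟩
    54 * (Δ * k) + 27 * X                           ≤⟨ +-mono-≤ (*-monoʳ-≤ 54 (*-monoˡ-≤ k Δ≤k)) (27X≤4k³+54k² {M = M} 1≤Δ Δ≤k X+MΔ≤ ΔX+M[M+3Δ]≤) ⟩
    54 * (k * k) + (4 * (k * k * k) + 54 * (k * k)) ≡⟨ identity₅ (k * k * k) (k * k) ⟩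
    4 * (k * k * k) + 108 * (k * k)                 ≡⟨ cong (λ c → 4 * c + 108 * (k * k)) (identity₃ k) ⟨
    4 * k ^ 3 + 108 * (k * k)                       ∎)

module Incidence {n : ℕ} (H : Hypergraph n) where

  inc : Fin (m H) → Fin n → ℕ
  inc i = χ (edge H i)

  degree : Fin n → ℕ
  degree v = ∑[ i < m H ] inc i v

  edgeSum : Fin (m H) → (Fin n → ℕ) → ℕ
  edgeSum i f = ∑[ v < n ] (f v * inc i v)

  Ord≡∑ : Ord H ≡ ∑[ v < n ] (1 ⊓ degree v)
  Ord≡∑ = trans (∣p∣≡∑χ (⋃ (List.tabulate (edge H)))) (sum-cong-≗ (χ-⋃ (edge H)))

  ∑-*-degree : (f : Fin n → ℕ) → ∑[ v < n ] (f v * degree v) ≡ ∑[ i < m H ] edgeSum i f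
  ∑-*-degree f = trans (sum-cong-≗ (λ v → *-distribˡ-sum (f v) (λ i → inc i v)))
                       (∑-comm (λ v i → f v * inc i v))

  edgeSum-+ : ∀ i (f g : Fin n → ℕ) → edgeSum i (λ v → f v + g v) ≡ edgeSum i f + edgeSum i g
  edgeSum-+ i f g = trans (sum-cong-≗ (λ v → *-distribʳ-+ (inc i v) (f v) (g v)))
                          (∑-distrib-+ (λ v → f v * inc i v) (λ v → g v * inc i v))

  edgeSum-*ˡ : ∀ i c (f : Fin n → ℕ) → edgeSum i (λ v → c * f v) ≡ c * edgeSum i f
  edgeSum-*ˡ i c f = trans (sum-cong-≗ (λ v → *-assoc c (f v) (inc i v)))
                           (sym (*-distribˡ-sum c (λ v → f v * inc i v)))

  edgeSum-mono-≤ : ∀ i {f g : Fin n → ℕ} → (∀ {v} → v ∈ edge H i → f v ≤ g v) →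
                   edgeSum i f ≤ edgeSum i g
  edgeSum-mono-≤ i {f} {g} f≤g = ∑-mono-≤ pointwise
    where
    pointwise : ∀ v → f v * inc i v ≤ g v * inc i v
    pointwise v with v ∈? edge H i
    ... | yes v∈e rewrite ∈⇒χ≡1 v∈e = *-monoˡ-≤ 1 (f≤g v∈e)
    ... | no  v∉e rewrite ∉⇒χ≡0 v∉e | *-zeroʳ (f v) | *-zeroʳ (g v) = z≤n

  edgeSum-≡0 : ∀ i {f : Fin n → ℕ} → (∀ {v} → v ∈ edge H i → f v ≡ 0) → edgeSum i f ≡ 0
  edgeSum-≡0 i f≡0 = n≤0⇒n≡0 (≤-trans (edgeSum-mono-≤ i (≤-reflexive ∘ f≡0))
                                      (≤-reflexive (∑-≡0 {n} {λ _ → 0} (λ _ → refl))))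

module OneIntersecting {n k : ℕ} {H : Hypergraph n}
                       (uniform : IsUniform k H) (one : IsOneIntersecting H) where

  open Incidence H

  ∑-inc : ∀ i → ∑[ v < n ] inc i v ≡ k
  ∑-inc i = trans (sym (∣p∣≡∑χ (edge H i))) (uniform i)

  edgeSum-1 : ∀ i → edgeSum i (λ _ → 1) ≡ k
  edgeSum-1 i = trans (sum-cong-≗ (λ v → *-identityˡ (inc i v))) (∑-inc i)

  edgeSum-inc-self : ∀ i → edgeSum i (inc i) ≡ k
  edgeSum-inc-self i = trans (sum-cong-≗ (χ-idem (edge H i))) (∑-inc i)

  ∑χ-∩ : ∀ {i j} → i ≢ j → ∑[ v < n ] χ (edge H i ∩ edge H j) v ≡ 1
  ∑χ-∩ {i} {j} i≢j = trans (sym (∣p∣≡∑χ (edge H i ∩ edge H j))) (one i j i≢j)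

  edgeSum-inc : ∀ {i j} → i ≢ j → edgeSum j (inc i) ≡ 1
  edgeSum-inc {i} {j} i≢j = trans (sum-cong-≗ (λ v → sym (χ-∩ (edge H i) (edge H j) v))) (∑χ-∩ i≢j)

  common-vertex : ∀ {i j} → i ≢ j → ∃ λ v → v ∈ edge H i × v ∈ edge H j
  common-vertex {i} {j} i≢j =
    let v , χ≢0 = ∑≢0⇒∃≢0 (χ (edge H i ∩ edge H j)) (λ ∑≡0 → 1+n≢0 (trans (sym (∑χ-∩ i≢j)) ∑≡0))
    in v , x∈p∩q⁻ (edge H i) (edge H j) (χ≢0⇒∈ χ≢0)

  common-vertex-unique : ∀ {i j v w} → i ≢ j → v ∈ edge H i → v ∈ edge H j →
                         w ∈ edge H i → w ∈ edge H j → v ≡ w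
  common-vertex-unique {i} {j} {v} {w} i≢j v∈i v∈j w∈i w∈j with v ≟ᶠ w
  ... | yes v≡w = v≡w
  ... | no  v≢w = ⊥-elim (<-irrefl refl (begin
    2                            ≡⟨ cong₂ _+_ (∈⇒χ≡1 (x∈p∩q⁺ (v∈i , v∈j))) (∈⇒χ≡1 (x∈p∩q⁺ (w∈i , w∈j))) ⟨
    χ i∩j v + χ i∩j w            ≤⟨ +-≤-∑ (χ i∩j) v≢w ⟩
    ∑[ u < n ] χ i∩j u           ≡⟨ ∑χ-∩ i≢j ⟩
    1                            ∎))
    where
    open ≤-Reasoning
    i∩j : Subset n
    i∩j = edge H i ∩ edge H j

  2≤degree : ∀ {i j v} → i ≢ j → v ∈ edge H i → v ∈ edge H j → 2 ≤ degree v
  2≤degree {i} {j} {v} i≢j v∈i v∈j =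
    subst₂ (λ x y → x + y ≤ degree v) (∈⇒χ≡1 v∈i) (∈⇒χ≡1 v∈j) (+-≤-∑ (λ i → inc i v) i≢j)

  edgeSum-degree : ∀ i → edgeSum i degree + 1 ≡ k + m H
  edgeSum-degree i = begin
    edgeSum i degree + 1                           ≡⟨ cong (_+ 1) (sum-cong-≗ (λ v → *-distribʳ-sum (inc i v) (λ j → inc j v))) ⟩
    ∑[ v < n ] ∑[ j < m H ] (inc j v * inc i v) + 1  ≡⟨ cong (_+ 1) (∑-comm (λ v j → inc j v * inc i v)) ⟩
    ∑[ j < m H ] edgeSum i (inc j) + 1             ≡⟨ ∑-except (λ j → edgeSum i (inc j)) i (λ j j≢i → edgeSum-inc j≢i) ⟩
    edgeSum i (inc i) + m H                        ≡⟨ cong (_+ m H) (edgeSum-inc-self i) ⟩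
    k + m H                                        ∎
    where open ≡-Reasoning

  all-through⇒sunflower : ∀ {v} → (∀ i → v ∈ edge H i) → IsSunflower H
  all-through⇒sunflower {v} v∈ i j i≢j = ⊆-antisym ∩⊆core core⊆∩
    where
    ∩⊆core : ∀ {w} → w ∈ edge H i ∩ edge H j → w ∈ coreSet H
    ∩⊆core w∈∩ with w∈i , w∈j ← x∈p∩q⁻ (edge H i) (edge H j) w∈∩
      rewrite common-vertex-unique i≢j w∈i w∈j (v∈ i) (v∈ j) = ∈-⋂⁺ (edge H) v∈
    core⊆∩ : ∀ {w} → w ∈ coreSet H → w ∈ edge H i ∩ edge H j
    core⊆∩ w∈core = x∈p∩q⁺ (∈-⋂⁻ (edge H) w∈core i , ∈-⋂⁻ (edge H) w∈core j)

  ¬sunflower⇒avoiding-edge : ¬ IsSunflower H → ∀ v → ∃ λ i → v ∉ edge H i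
  ¬sunflower⇒avoiding-edge ¬sunflower v =
    Fin.¬∀⟶∃¬ (m H) (λ i → v ∈ edge H i) (λ i → v ∈? edge H i) (¬sunflower ∘ all-through⇒sunflower)

  module _ {a b : Fin (m H)} (a≢b : a ≢ b) where

    another-edge : ∀ i → ∃ λ j → i ≢ j
    another-edge i with i ≟ᶠ a
    ... | yes refl = b , a≢b
    ... | no  i≢a  = a , i≢a

    shared-high-degree-vertex : ∀ i j → ∃ λ v → 2 ≤ degree v × v ∈ edge H i × v ∈ edge H j
    shared-high-degree-vertex i j with i ≟ᶠ j
    ... | no i≢j = let v , v∈i , v∈j = common-vertex i≢j in v , 2≤degree i≢j v∈i v∈j , v∈i , v∈j
    ... | yes refl =
      let j , i≢j = another-edge i
          v , v∈i , v∈j = common-vertex i≢j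
      in v , 2≤degree i≢j v∈i v∈j , v∈i , v∈i

    highDegree : Subset n
    highDegree = tabulate (λ v → does (2 ≤? degree v))

    χ-highDegree : ∀ v → χ highDegree v ≡ 𝟙 (does (2 ≤? degree v))
    χ-highDegree v = cong 𝟙 (lookup∘tabulate _ v)

    highDegree-isKernel : IsKernel H highDegree
    highDegree-isKernel = meets , pairwise
      where
      ∈-highDegree : ∀ {v} → 2 ≤ degree v → v ∈ highDegree
      ∈-highDegree {v} 2≤d = lookup⇒[]= v highDegree (trans (lookup∘tabulate _ v) (dec-true (2 ≤? degree v) 2≤d))
      meets : ∀ i → Nonempty (highDegree ∩ edge H i)
      meets i = let v , 2≤d , v∈i , _ = shared-high-degree-vertex i i
                in v , x∈p∩q⁺ (∈-highDegree 2≤d , v∈i)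
      pairwise : ∀ i j → Nonempty ((highDegree ∩ edge H i) ∩ (highDegree ∩ edge H j))
      pairwise i j = let v , 2≤d , v∈i , v∈j = shared-high-degree-vertex i j
                     in v , x∈p∩q⁺ (x∈p∩q⁺ (∈-highDegree 2≤d , v∈i) , x∈p∩q⁺ (∈-highDegree 2≤d , v∈j))

    Ord+Ker≤∑[2⊓degree] : ∀ {c} → IsKer H c → Ord H + c ≤ ∑[ v < n ] (2 ⊓ degree v)
    Ord+Ker≤∑[2⊓degree] {c} (_ , minimal) = begin
      Ord H + c                                                 ≤⟨ +-monoʳ-≤ (Ord H) (minimal highDegree highDegree-isKernel) ⟩
      Ord H + ∣ highDegree ∣                                    ≡⟨ cong₂ _+_ Ord≡∑ (trans (∣p∣≡∑χ highDegree) (sum-cong-≗ χ-highDegree)) ⟩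
      ∑[ v < n ] (1 ⊓ degree v) + ∑[ v < n ] (𝟙 (does (2 ≤? degree v))) ≡⟨ ∑-distrib-+ (λ v → 1 ⊓ degree v) (λ v → 𝟙 (does (2 ≤? degree v))) ⟨
      ∑[ v < n ] (1 ⊓ degree v + 𝟙 (does (2 ≤? degree v)))     ≡⟨ sum-cong-≗ (λ v → 1⊓d+[2≤d]≡2⊓d (degree v)) ⟩
      ∑[ v < n ] (2 ⊓ degree v)                                   ∎
      where
      open ≤-Reasoning
      1⊓d+[2≤d]≡2⊓d : ∀ d → 1 ⊓ d + 𝟙 (does (2 ≤? d)) ≡ 2 ⊓ d
      1⊓d+[2≤d]≡2⊓d 0             = refl
      1⊓d+[2≤d]≡2⊓d 1             = refl
      1⊓d+[2≤d]≡2⊓d (suc (suc d)) = refl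

module Star {n k : ℕ} {H : Hypergraph n} (uniform : IsUniform k H) (one : IsOneIntersecting H)
            (v₀ : Fin n) (maximal : ∀ v → Incidence.degree H v ≤ Incidence.degree H v₀) where

  open Incidence H
  open OneIntersecting {H = H} uniform one

  Δ : ℕ
  Δ = degree v₀

  star : Fin (m H) → ℕ
  star i = inc i v₀

  avoids : Fin (m H) → ℕ
  avoids i = 1 ∸ star i

  M : ℕ
  M = ∑[ i < m H ] avoids i

  star-cases : ∀ i → (v₀ ∈ edge H i × star i ≡ 1 × avoids i ≡ 0) ⊎ (v₀ ∉ edge H i × star i ≡ 0 × avoids i ≡ 1)
  star-cases i with v₀ ∈? edge H i
  ... | yes v₀∈i = inj₁ (v₀∈i , ∈⇒χ≡1 v₀∈i , cong (1 ∸_) (∈⇒χ≡1 v₀∈i))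
  ... | no  v₀∉i = inj₂ (v₀∉i , ∉⇒χ≡0 v₀∉i , cong (1 ∸_) (∉⇒χ≡0 v₀∉i))

  m≡Δ+M : m H ≡ Δ + M
  m≡Δ+M = begin
    m H                                     ≡⟨ *-identityʳ (m H) ⟨
    m H * 1                                 ≡⟨ ∑-const (m H) 1 ⟨
    ∑[ i < m H ] 1                          ≡⟨ sum-cong-≗ (λ i → m+[n∸m]≡n (χ≤1 (edge H i) v₀)) ⟨
    ∑[ i < m H ] (star i + avoids i)        ≡⟨ ∑-distrib-+ star avoids ⟩
    Δ + M                                   ∎
    where open ≡-Reasoning

  starDegree : Fin n → ℕ
  starDegree v = ∑[ i < m H ] (star i * inc i v)

  uncovered : Fin n → ℕ
  uncovered v = 1 ∸ starDegree v

  covered : Fin n → ℕ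
  covered v = 1 ⊓ starDegree v

  cover-cases : ∀ v → (starDegree v ≡ 0 × uncovered v ≡ 1 × covered v ≡ 0)
                    ⊎ (1 ≤ starDegree v × uncovered v ≡ 0 × covered v ≡ 1)
  cover-cases v with starDegree v
  ... | zero  = inj₁ (refl , refl , refl)
  ... | suc s = inj₂ (s≤s z≤n , 0∸n≡0 s , refl)

  uncovered+covered : ∀ v → uncovered v + covered v ≡ 1
  uncovered+covered v with cover-cases v
  ... | inj₁ (_ , u≡1 , c≡0) rewrite u≡1 | c≡0 = refl
  ... | inj₂ (_ , u≡0 , c≡1) rewrite u≡0 | c≡1 = refl

  ∑-starDegree : ∑[ v < n ] starDegree v ≡ Δ * k
  ∑-starDegree = begin
    ∑[ v < n ] ∑[ i < m H ] (star i * inc i v)   ≡⟨ ∑-comm (λ v i → star i * inc i v) ⟩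
    ∑[ i < m H ] ∑[ v < n ] (star i * inc i v)   ≡⟨ sum-cong-≗ (λ i → *-distribˡ-sum (star i) (inc i)) ⟨
    ∑[ i < m H ] (star i * ∑[ v < n ] inc i v)   ≡⟨ sum-cong-≗ (λ i → cong (star i *_) (∑-inc i)) ⟩
    ∑[ i < m H ] (star i * k)                    ≡⟨ *-distribʳ-sum k star ⟨
    Δ * k                                        ∎
    where open ≡-Reasoning

  uncovered-on-star-edge : ∀ {i v} → v₀ ∈ edge H i → v ∈ edge H i → uncovered v ≡ 0
  uncovered-on-star-edge {i} {v} v₀∈i v∈i = m≤n⇒m∸n≡0 (begin
    1                       ≡⟨ cong₂ _*_ (∈⇒χ≡1 v₀∈i) (∈⇒χ≡1 v∈i) ⟨
    star i * inc i v        ≤⟨ ≤-∑ (λ j → star j * inc j v) i ⟩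
    starDegree v            ∎)
    where open ≤-Reasoning

  starDegree≤1 : ∀ {v} → v ≢ v₀ → starDegree v ≤ 1
  starDegree≤1 {v} v≢v₀ = ∑-≤-1 (λ i → star i * inc i v) (λ i → *-mono-≤ (χ≤1 (edge H i) v₀) (χ≤1 (edge H i) v)) unique
    where
    factors≢0 : ∀ {x y} → x * y ≢ 0 → x ≢ 0 × y ≢ 0
    factors≢0 {x} {y} xy≢0 = (λ x≡0 → xy≢0 (cong (_* y) x≡0)) , (λ y≡0 → xy≢0 (trans (cong (x *_) y≡0) (*-zeroʳ x)))
    unique : ∀ {i j} → star i * inc i v ≢ 0 → star j * inc j v ≢ 0 → i ≡ j
    unique {i} {j} ≢0ᵢ ≢0ⱼ with i ≟ᶠ j | factors≢0 ≢0ᵢ | factors≢0 ≢0ⱼ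
    ... | yes i≡j | _ | _ = i≡j
    ... | no  i≢j | v₀∈i , v∈i | v₀∈j , v∈j =
      ⊥-elim (v≢v₀ (common-vertex-unique i≢j (χ≢0⇒∈ v∈i) (χ≢0⇒∈ v∈j) (χ≢0⇒∈ v₀∈i) (χ≢0⇒∈ v₀∈j)))

  edgeSum-starDegree : ∀ {i} → v₀ ∉ edge H i → edgeSum i starDegree ≡ Δ
  edgeSum-starDegree {i} v₀∉i = begin
    ∑[ v < n ] (∑[ j < m H ] (star j * inc j v) * inc i v)  ≡⟨ sum-cong-≗ (λ v → *-distribʳ-sum (inc i v) (λ j → star j * inc j v)) ⟩
    ∑[ v < n ] ∑[ j < m H ] (star j * inc j v * inc i v)    ≡⟨ ∑-comm (λ v j → star j * inc j v * inc i v) ⟩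
    ∑[ j < m H ] ∑[ v < n ] (star j * inc j v * inc i v)    ≡⟨ sum-cong-≗ (λ j → edgeSum-*ˡ i (star j) (inc j)) ⟩
    ∑[ j < m H ] (star j * edgeSum i (inc j))               ≡⟨ sum-cong-≗ meets-once ⟩
    Δ                                                       ∎
    where
    open ≡-Reasoning
    meets-once : ∀ j → star j * edgeSum i (inc j) ≡ star j
    meets-once j with star-cases j
    ... | inj₁ (v₀∈j , star≡1 , _) rewrite star≡1 = trans (+-identityʳ _) (edgeSum-inc (λ { refl → v₀∉i v₀∈j }))
    ... | inj₂ (_ , star≡0 , _) rewrite star≡0 = refl

  Δ≤edgeSum-covered : ∀ {i} → v₀ ∉ edge H i → Δ ≤ edgeSum i covered
  Δ≤edgeSum-covered {i} v₀∉i = subst (_≤ edgeSum i covered) (edgeSum-starDegree v₀∉i)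
    (edgeSum-mono-≤ i (λ {v} v∈i → ≤-reflexive (sym (trans (⊓-comm 1 (starDegree v))
                                                       (m≤n⇒m⊓n≡m (starDegree≤1 (λ { refl → v₀∉i v∈i })))))))

  edgeSum-uncovered+covered : ∀ i → edgeSum i uncovered + edgeSum i covered ≡ k
  edgeSum-uncovered+covered i = begin
    edgeSum i uncovered + edgeSum i covered            ≡⟨ edgeSum-+ i uncovered covered ⟨
    edgeSum i (λ v → uncovered v + covered v)          ≡⟨ sum-cong-≗ (λ v → cong (_* inc i v) (uncovered+covered v)) ⟩
    edgeSum i (λ _ → 1)                                ≡⟨ edgeSum-1 i ⟩
    k                                                  ∎
    where open ≡-Reasoning

  avoiding-edges-bound : (A : Fin (m H) → ℕ) (c C : ℕ) → (∀ {i} → v₀ ∈ edge H i → A i ≡ 0) →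
                         (∀ {i} → v₀ ∉ edge H i → A i + c ≤ C) → sum A + M * c ≤ M * C
  avoiding-edges-bound A c C on-star off-star = begin
    sum A + M * c                             ≡⟨ cong (sum A +_) (*-distribʳ-sum c avoids) ⟩
    sum A + ∑[ i < m H ] (avoids i * c)       ≡⟨ ∑-distrib-+ A (λ i → avoids i * c) ⟨
    ∑[ i < m H ] (A i + avoids i * c)         ≤⟨ ∑-mono-≤ pointwise ⟩
    ∑[ i < m H ] (avoids i * C)               ≡⟨ *-distribʳ-sum C avoids ⟨
    M * C                                     ∎
    where
    open ≤-Reasoning
    pointwise : ∀ i → A i + avoids i * c ≤ avoids i * C
    pointwise i with star-cases i
    ... | inj₁ (v₀∈i , _ , avoids≡0) rewrite on-star v₀∈i | avoids≡0 = z≤n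
    ... | inj₂ (v₀∉i , _ , avoids≡1) rewrite avoids≡1 | *-identityˡ c | *-identityˡ C = off-star v₀∉i

  1≤Δ : ∀ {a b} → a ≢ b → 1 ≤ Δ
  1≤Δ a≢b = let v , v∈a , v∈b = common-vertex a≢b in ≤-trans (≤-trans (n≤1+n 1) (2≤degree a≢b v∈a v∈b)) (maximal v)

  Δ≤k : ∀ {i} → v₀ ∉ edge H i → Δ ≤ k
  Δ≤k {i} v₀∉i = ≤-trans (Δ≤edgeSum-covered v₀∉i)
                         (subst (edgeSum i covered ≤_) (edgeSum-uncovered+covered i) (m≤n+m _ _))

  X : ℕ
  X = ∑[ v < n ] (uncovered v * (2 ⊓ degree v))

  ∑[2⊓degree]≤2Δk+X : ∑[ v < n ] (2 ⊓ degree v) ≤ 2 * (Δ * k) + X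
  ∑[2⊓degree]≤2Δk+X = begin
    ∑[ v < n ] (2 ⊓ degree v)                                           ≤⟨ ∑-mono-≤ pointwise ⟩
    ∑[ v < n ] (2 * starDegree v + uncovered v * (2 ⊓ degree v))        ≡⟨ ∑-distrib-+ (λ v → 2 * starDegree v) (λ v → uncovered v * (2 ⊓ degree v)) ⟩
    ∑[ v < n ] (2 * starDegree v) + X                                   ≡⟨ cong (_+ X) (*-distribˡ-sum 2 starDegree) ⟨
    2 * ∑[ v < n ] starDegree v + X                                     ≡⟨ cong (λ t → 2 * t + X) ∑-starDegree ⟩
    2 * (Δ * k) + X                                                     ∎
    where
    open ≤-Reasoning
    pointwise : ∀ v → 2 ⊓ degree v ≤ 2 * starDegree v + uncovered v * (2 ⊓ degree v)
    pointwise v with cover-cases v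
    ... | inj₁ (starDegree≡0 , uncovered≡1 , _) rewrite starDegree≡0 | uncovered≡1 = ≤-reflexive (sym (+-identityʳ _))
    ... | inj₂ (1≤starDegree , uncovered≡0 , _) rewrite uncovered≡0 =
      ≤-trans (m⊓n≤m 2 (degree v)) (≤-trans (*-monoʳ-≤ 2 1≤starDegree) (m≤m+n _ 0))

  X+MΔ≤Mk : X + M * Δ ≤ M * k
  X+MΔ≤Mk = begin
    X + M * Δ                                         ≤⟨ +-monoˡ-≤ (M * Δ) (∑-mono-≤ (λ v → *-monoʳ-≤ (uncovered v) (m⊓n≤n 2 (degree v)))) ⟩
    ∑[ v < n ] (uncovered v * degree v) + M * Δ       ≡⟨ cong (_+ M * Δ) (∑-*-degree uncovered) ⟩
    ∑[ i < m H ] edgeSum i uncovered + M * Δ          ≤⟨ avoiding-edges-bound (λ i → edgeSum i uncovered) Δ k on-star off-star ⟩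
    M * k                                             ∎
    where
    open ≤-Reasoning
    on-star : ∀ {i} → v₀ ∈ edge H i → edgeSum i uncovered ≡ 0
    on-star {i} v₀∈i = edgeSum-≡0 i (uncovered-on-star-edge v₀∈i)
    off-star : ∀ {i} → v₀ ∉ edge H i → edgeSum i uncovered + Δ ≤ k
    off-star {i} v₀∉i = subst (edgeSum i uncovered + Δ ≤_) (edgeSum-uncovered+covered i)
                              (+-monoʳ-≤ (edgeSum i uncovered) (Δ≤edgeSum-covered v₀∉i))

  deficit : Fin (m H) → ℕ
  deficit i = edgeSum i (λ v → uncovered v * (Δ + 2 ∸ degree v))

  ΔX≤∑deficit : Δ * X ≤ ∑[ i < m H ] deficit i
  ΔX≤∑deficit = begin
    Δ * X                                                       ≡⟨ *-distribˡ-sum Δ (λ v → uncovered v * (2 ⊓ degree v)) ⟩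
    ∑[ v < n ] (Δ * (uncovered v * (2 ⊓ degree v)))             ≤⟨ ∑-mono-≤ pointwise ⟩
    ∑[ v < n ] (uncovered v * (Δ + 2 ∸ degree v) * degree v)    ≡⟨ ∑-*-degree (λ v → uncovered v * (Δ + 2 ∸ degree v)) ⟩
    ∑[ i < m H ] deficit i                                      ∎
    where
    open ≤-Reasoning
    identity : ∀ Δ u w → Δ * (u * w) ≡ u * (Δ * w)
    identity = solve-∀
    pointwise : ∀ v → Δ * (uncovered v * (2 ⊓ degree v)) ≤ uncovered v * (Δ + 2 ∸ degree v) * degree v
    pointwise v = begin
      Δ * (uncovered v * (2 ⊓ degree v))               ≡⟨ identity Δ (uncovered v) (2 ⊓ degree v) ⟩
      uncovered v * (Δ * (2 ⊓ degree v))               ≤⟨ *-monoʳ-≤ (uncovered v) (Δ*[2⊓d]≤d*[Δ+2∸d] (degree v) (maximal v)) ⟩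
      uncovered v * (degree v * (Δ + 2 ∸ degree v))    ≡⟨ cong (uncovered v *_) (*-comm (degree v) _) ⟩
      uncovered v * ((Δ + 2 ∸ degree v) * degree v)    ≡⟨ *-assoc (uncovered v) _ (degree v) ⟨
      uncovered v * (Δ + 2 ∸ degree v) * degree v      ∎

  deficit-on-star : ∀ {i} → v₀ ∈ edge H i → deficit i ≡ 0
  deficit-on-star {i} v₀∈i = edgeSum-≡0 i {λ v → uncovered v * (Δ + 2 ∸ degree v)}
                               (λ {v} v∈i → cong (_* (Δ + 2 ∸ degree v)) (uncovered-on-star-edge v₀∈i v∈i))

  deficit-off-star : ∀ {i} → v₀ ∉ edge H i → deficit i + (m H + 2 * Δ) ≤ Δ * k + k + 1
  deficit-off-star {i} v₀∉i =
    edge-count-bound deficit+S≤ (edgeSum-degree i) (edgeSum-uncovered+covered i) (Δ≤edgeSum-covered v₀∉i)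
    where
    open ≤-Reasoning
    pointwise : ∀ v → uncovered v * (Δ + 2 ∸ degree v) + degree v ≤ (Δ + 2) * uncovered v + Δ * covered v
    pointwise v with cover-cases v
    ... | inj₁ (_ , uncovered≡1 , covered≡0) rewrite uncovered≡1 | covered≡0 = ≤-reflexive (begin-equality
      1 * (Δ + 2 ∸ degree v) + degree v    ≡⟨ cong (_+ degree v) (*-identityˡ _) ⟩
      Δ + 2 ∸ degree v + degree v          ≡⟨ m∸n+n≡m (≤-trans (maximal v) (m≤m+n Δ 2)) ⟩
      Δ + 2                                ≡⟨ *-identityʳ (Δ + 2) ⟨
      (Δ + 2) * 1                          ≡⟨ +-identityʳ _ ⟨
      (Δ + 2) * 1 + 0                      ≡⟨ cong ((Δ + 2) * 1 +_) (*-zeroʳ Δ) ⟨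
      (Δ + 2) * 1 + Δ * 0                  ∎)
    ... | inj₂ (_ , uncovered≡0 , covered≡1) rewrite uncovered≡0 | covered≡1 | *-zeroʳ (Δ + 2) | *-identityʳ Δ = maximal v
    deficit+S≤ : deficit i + edgeSum i degree ≤ (Δ + 2) * edgeSum i uncovered + Δ * edgeSum i covered
    deficit+S≤ = begin
      deficit i + edgeSum i degree                                              ≡⟨ edgeSum-+ i (λ v → uncovered v * (Δ + 2 ∸ degree v)) degree ⟨
      edgeSum i (λ v → uncovered v * (Δ + 2 ∸ degree v) + degree v)             ≤⟨ edgeSum-mono-≤ i (λ {v} _ → pointwise v) ⟩
      edgeSum i (λ v → (Δ + 2) * uncovered v + Δ * covered v)                   ≡⟨ edgeSum-+ i (λ v → (Δ + 2) * uncovered v) (λ v → Δ * covered v) ⟩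
      edgeSum i (λ v → (Δ + 2) * uncovered v) + edgeSum i (λ v → Δ * covered v) ≡⟨ cong₂ _+_ (edgeSum-*ˡ i (Δ + 2) uncovered) (edgeSum-*ˡ i Δ covered) ⟩
      (Δ + 2) * edgeSum i uncovered + Δ * edgeSum i covered                     ∎

  ΔX+M[M+3Δ]≤M[Δk+k+1] : Δ * X + M * (M + 3 * Δ) ≤ M * (Δ * k + k + 1)
  ΔX+M[M+3Δ]≤M[Δk+k+1] = begin
    Δ * X + M * (M + 3 * Δ)                     ≤⟨ +-monoˡ-≤ (M * (M + 3 * Δ)) ΔX≤∑deficit ⟩
    ∑[ i < m H ] deficit i + M * (M + 3 * Δ)    ≡⟨ cong (λ t → ∑[ i < m H ] deficit i + M * t) M+3Δ≡m+2Δ ⟩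
    ∑[ i < m H ] deficit i + M * (m H + 2 * Δ)  ≤⟨ avoiding-edges-bound deficit (m H + 2 * Δ) (Δ * k + k + 1)
                                                                        deficit-on-star deficit-off-star ⟩
    M * (Δ * k + k + 1)                         ∎
    where
    open ≤-Reasoning
    identity : ∀ M Δ → M + 3 * Δ ≡ Δ + M + 2 * Δ
    identity = solve-∀
    M+3Δ≡m+2Δ : M + 3 * Δ ≡ m H + 2 * Δ
    M+3Δ≡m+2Δ = trans (identity M Δ) (cong (_+ 2 * Δ) (sym m≡Δ+M))

theorem3p1 : (k : ℕ) → 1 ≤ k → (n : ℕ) → (H : Hypergraph n) →
    IsUniform k H → IsOneIntersecting H → ¬ IsSunflower H →
    (c : ℕ) → IsKer H c → BoundHolds k (Ord H + c)
theorem3p1 k _ n H uniform one ¬sunflower c isKer with distinct-pair ¬sunflower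
... | _ , _ , a≢b =
  boundHolds {M = M} (1≤Δ a≢b) (Δ≤k (proj₂ (¬sunflower⇒avoiding-edge ¬sunflower v₀)))
             (≤-trans (Ord+Ker≤∑[2⊓degree] a≢b isKer) ∑[2⊓degree]≤2Δk+X) X+MΔ≤Mk ΔX+M[M+3Δ]≤M[Δk+k+1]
  where
  open Incidence H
  open OneIntersecting {H = H} uniform one
  v₀ : Fin n
  v₀ = argmax degree (proj₁ (common-vertex a≢b)) (List.allFin n)
  maximal : ∀ v → degree v ≤ degree v₀
  maximal v = All.lookup (f[xs]≤f[argmax] _ (List.allFin n)) (∈-allFin v)
  open Star {H = H} uniform one v₀ maximal
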